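{- Let $n \ge 1$ and let $U \subseteq \mathbb{Z}_3^n$ be a $1$-saturated canonical set with extra point $x_U \in \mathbb{Z}_3^{n-1}$. Then for every affine subset $H \subseteq \mathbb{Z}_3^n$ containing the direction $e_1$, writing $H = \mathbb{Z}_3 \times H_{red}$, if $x_U \in H_{red}$ then $U \cap H$ is a canonical set for $H$.
   Context: $H(n,3)$ is the Hamming graph on $\mathbb{Z}_3^n$ (vertices adjacent iff they differ in exactly one coordinate); $e_1,\dots,e_n$ is the standard basis. $U$ is $1$-saturated if $U \cap \{x,x+e_1,x+2e_1\} \neq \emptyset$ for all $x$. $U \subseteq \mathbb{Z}_3^n$ is canonical if $|U| \ge 3^{n-1}+1$, $U$ is disjoint from some maximum size independent set of $H(n,3)$, and the subgraph induced by $U$ has maximum degree at most $1$. Write $U = \bigcup_{x \in \mathbb{Z}_3^{n-1}} U_f(x) \times \{x\}$ with $U_f(x) \subseteq \mathbb{Z}_3$ (the first coordinate is separated off). For a $1$-saturated canonical $U$, its extra point $x_U$ is the unique $x \in \mathbb{Z}_3^{n-1}$ with $|U_f(x)| = 2$. An affine subset is a set $H = \{x \in \mathbb{Z}_3^n : x_i = c_i \text{ for all } i \in R_H\}$ for some $R_H \subseteq [n]$ and constants $c_i \in \mathbb{Z}_3$; it contains direction $e_i$ if $i \notin R_H$. If $H$ contains $e_1$, $H_{red} \subseteq \mathbb{Z}_3^{n-1}$ is defined by $H = \mathbb{Z}_3 \times H_{red}$. For an affine subset $H$ with $d = n - |R_H|$ free coordinates, identify $H$ with $\mathbb{Z}_3^d$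 via its free coordinates (so the Hamming graph on $H$ is $H(d,3)$); a set $V \subseteq H$ is a canonical set for $H$ if it is canonical under this identification. -}

module Defs where

open import Data.Nat using (ℕ; zero; suc; _+_; _^_; _∸_; _≤_)
open import Data.Fin using (Fin; zero; suc)
open import Data.Fin.Properties using (_≟_)
open import Data.Vec using (Vec; []; _∷_; head; tail)
open import Data.List using (List; []; _∷_; map; concatMap; allFin)
open import Data.Nat.ListAction using (sum)
open import Data.Bool using (Bool; true; false; _∧_; _∨_; if_then_else_)
open import Data.Maybe using (Maybe; just; nothing)
open import Data.Product using (Σ; _×_)
open import Relation.Nullary using (¬_; yes; no)
open import Relation.Binary.PropositionalEquality using (_≡_)

Pt : ℕ → Set
Pt n = Vec (Fin 3) n

Subset3 : ℕ → Set
Subset3 n = Pt n → Bool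

_+₃_ : Fin 3 → Fin 3 → Fin 3
zero +₃ b = b
suc zero +₃ zero = suc zero
suc zero +₃ suc zero = suc (suc zero)
suc zero +₃ suc (suc zero) = zero
suc (suc zero) +₃ zero = suc (suc zero)
suc (suc zero) +₃ suc zero = zero
suc (suc zero) +₃ suc (suc zero) = suc zero

_⊕_ : ∀ {n} → Pt n → Pt n → Pt n
[] ⊕ [] = []
(a ∷ x) ⊕ (b ∷ y) = (a +₃ b) ∷ (x ⊕ y)

e : ∀ {n} → Fin n → Pt n
e {suc n} zero = suc zero ∷ Data.Vec.replicate n zero
e {suc n} (suc i) = zero ∷ e i

allPts : (n : ℕ) → List (Pt n)
allPts zero = [] ∷ []
allPts (suc n) = concatMap (λ a → map (a ∷_) (allPts n)) (allFin 3)

count : ∀ {n} → Subset3 n → ℕ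
count {n} U = sum (map (λ x → if U x then 1 else 0) (allPts n))

size : ∀ {n} → Subset3 n → ℕ
size = count

dist : ∀ {n} → Pt n → Pt n → ℕ
dist [] [] = 0
dist (a ∷ x) (b ∷ y) with a ≟ b
... | yes _ = dist x y
... | no _ = suc (dist x y)

adj? : ∀ {n} → Pt n → Pt n → Bool
adj? x y with dist x y
... | 1 = true
... | _ = false

Adjacent : ∀ {n} → Pt n → Pt n → Set
Adjacent x y = adj? x y ≡ true

Independent : ∀ {n} → Subset3 n → Set
Independent I = ∀ x y → I x ≡ true → I y ≡ true → ¬ Adjacent x y

MaxIndependent : ∀ {n} → Subset3 n → Set
MaxIndependent {n} I = Independent I × ((J : Subset3 n) → Independent J → size J ≤ size I)

Disjoint : ∀ {n} → Subset3 n → Subset3 n → Set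
Disjoint U I = ∀ x → U x ≡ true → I x ≡ false

degIn : ∀ {n} → Subset3 n → Pt n → ℕ
degIn {n} U x = count {n} (λ y → U y ∧ adj? x y)

MaxDegAtMost1 : ∀ {n} → Subset3 n → Set
MaxDegAtMost1 U = ∀ x → U x ≡ true → degIn U x ≤ 1

Canonical : ∀ {n} → Subset3 n → Set
Canonical {n} U =
  (3 ^ (n ∸ 1) + 1 ≤ size U)
  × Σ (Subset3 n) (λ I → MaxIndependent I × Disjoint U I)
  × MaxDegAtMost1 U

OneSaturated : ∀ {n} → Subset3 (suc n) → Set
OneSaturated U = ∀ x → (U x ∨ U (x ⊕ e zero) ∨ U (x ⊕ (e zero ⊕ e zero))) ≡ true

fiberSize : ∀ {n} → Subset3 (suc n) → Pt n → ℕ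
fiberSize U x = count {1} (λ a → U (head a ∷ x))

IsExtraPoint : ∀ {n} → Subset3 (suc n) → Pt n → Set
IsExtraPoint U xU = (fiberSize U xU ≡ 2) × (∀ y → fiberSize U y ≡ 2 → y ≡ xU)

-- affine subsets: nothing = free coordinate, just c = fixed coordinate x_i = c
Affine : ℕ → Set
Affine n = Vec (Maybe (Fin 3)) n

inAff? : ∀ {n} → Affine n → Pt n → Bool
inAff? [] [] = true
inAff? (nothing ∷ H) (a ∷ x) = inAff? H x
inAff? (just c ∷ H) (a ∷ x) with c ≟ a
... | yes _ = inAff? H x
... | no _ = false

ContainsDir : ∀ {n} → Affine n → Fin n → Set
ContainsDir H i = Data.Vec.lookup H i ≡ nothing

Hred : ∀ {n} → Affine (suc n) → Affine n
Hred H = tail H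

dim : ∀ {n} → Affine n → ℕ
dim [] = 0
dim (nothing ∷ H) = suc (dim H)
dim (just c ∷ H) = dim H

-- identification ℤ₃^(dim H) ≅ H via the free coordinates
embed : ∀ {n} (H : Affine n) → Pt (dim H) → Pt n
embed [] y = []
embed (nothing ∷ H) (a ∷ y) = a ∷ embed H y
embed (just c ∷ H) y = c ∷ embed H y

_∩_ : ∀ {n} → Subset3 n → Subset3 n → Subset3 n
(U ∩ V) x = U x ∧ V x

CanonicalFor : ∀ {n} (H : Affine n) → Subset3 n → Set
CanonicalFor H V = (∀ x → V x ≡ true → inAff? H x ≡ true) × Canonical (λ y → V (embed H y))

-- Each line in direction e₁ is a clique of H(n,3), so an independent set meets it at most
-- once; the zero-coordinate-sum code meets every line exactly once, so a maximum independent
-- set I of H(n,3) has size 3^(n-1) and meets every line exactly once.  Hence on a cylinder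
-- H = ℤ₃ × H_red the restriction of I is still a maximum independent set.  Saturation puts at
-- least one point of U on every line and the extra point puts two on the line over x_U, so
-- |U ∩ H| ≥ 3^(dim H - 1) + 1; degrees in the induced subgraph can only drop on restriction.
module Submission where

open import Algebra.Properties.CommutativeSemigroup as CommSemigroupProperties using ()
open import Data.Bool using (Bool; true; false; _∧_; _∨_; if_then_else_)
open import Data.Bool.Properties using (∧-identityʳ)
open import Data.Empty using (⊥-elim)
open import Data.Fin using (Fin; zero; suc)
open import Data.Fin.Properties using (_≟_)
open import Data.List using (List; []; _∷_; _++_; map; concatMap; allFin)
open import Data.List.Membership.Propositional using (_∈_; lose)
open import Data.List.Membership.Propositional.Properties using (∈-map⁺; ∈-concatMap⁺; ∈-allFin)
open import Data.List.Properties using (map-++; map-∘; map-cong)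
open import Data.List.Relation.Unary.Any using (here; there)
open import Data.Maybe using (just; nothing)
open import Data.Nat using (ℕ; zero; suc; pred; _+_; _*_; _^_; _≤_; _<_; z≤n; s≤s)
open import Data.Nat.ListAction using (sum)
open import Data.Nat.ListAction.Properties using (sum-++)
open import Data.Nat.Properties
  using (≤-refl; ≤-reflexive; ≤-trans; ≤-antisym; ≮⇒≥; n≮n; m≤m+n; m≤n+m; +-comm; +-mono-≤;
         +-mono-<-≤; +-mono-≤-<; *-zeroʳ; *-distribˡ-+; +-commutativeSemigroup; module ≤-Reasoning)
open import Data.Product using (Σ; _,_)
open import Data.Vec using ([]; _∷_; head; replicate)
open import Defs
open import Function using (_∘_)
open import Relation.Nullary using (does; yes; no)
open import Relation.Binary.PropositionalEquality

open CommSemigroupProperties +-commutativeSemigroup using (interchange)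

module _ {A : Set} where

  sum-map-+ : ∀ (f g : A → ℕ) xs →
              sum (map (λ x → f x + g x) xs) ≡ sum (map f xs) + sum (map g xs)
  sum-map-+ f g []       = refl
  sum-map-+ f g (x ∷ xs) =
    trans (cong (f x + g x +_) (sum-map-+ f g xs)) (interchange (f x) (g x) _ _)

  sum-map-* : ∀ k (f : A → ℕ) xs → sum (map (λ x → k * f x) xs) ≡ k * sum (map f xs)
  sum-map-* k f []       = sym (*-zeroʳ k)
  sum-map-* k f (x ∷ xs) =
    trans (cong (k * f x +_) (sum-map-* k f xs)) (sym (*-distribˡ-+ k (f x) _))

  sum-map-mono-≤ : ∀ {f g : A → ℕ} → (∀ x → f x ≤ g x) → ∀ xs → sum (map f xs) ≤ sum (map g xs)
  sum-map-mono-≤ f≤g []       = z≤n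
  sum-map-mono-≤ f≤g (x ∷ xs) = +-mono-≤ (f≤g x) (sum-map-mono-≤ f≤g xs)

  sum-map-mono-< : ∀ {f g : A → ℕ} → (∀ x → f x ≤ g x) →
                   ∀ {x xs} → x ∈ xs → f x < g x → sum (map f xs) < sum (map g xs)
  sum-map-mono-< f≤g {xs = _ ∷ xs} (here refl) fx<gx =
    +-mono-<-≤ fx<gx (sum-map-mono-≤ f≤g xs)
  sum-map-mono-< f≤g (there x∈xs) fx<gx =
    +-mono-≤-< (f≤g _) (sum-map-mono-< f≤g x∈xs fx<gx)

  ∈⇒≤sum-map : ∀ (f : A → ℕ) {x xs} → x ∈ xs → f x ≤ sum (map f xs)
  ∈⇒≤sum-map f (here refl)  = m≤m+n _ _
  ∈⇒≤sum-map f (there x∈xs) = ≤-trans (∈⇒≤sum-map f x∈xs) (m≤n+m _ _)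

sum-map-zero : ∀ {A : Set} (xs : List A) → sum (map (λ _ → 0) xs) ≡ 0
sum-map-zero []       = refl
sum-map-zero (_ ∷ xs) = sum-map-zero xs

sum-map-concatMap : ∀ {A B C : Set} (h : B → C → A) (f : A → ℕ) xs ys →
  sum (map f (concatMap (λ b → map (h b) ys) xs)) ≡
  sum (map (λ c → sum (map (λ b → f (h b c)) xs)) ys)
sum-map-concatMap h f []       ys = sym (sum-map-zero ys)
sum-map-concatMap h f (b ∷ xs) ys = begin
    sum (map f (map (h b) ys ++ rest))
  ≡⟨ cong sum (map-++ f (map (h b) ys) rest) ⟩
    sum (map f (map (h b) ys) ++ map f rest)
  ≡⟨ sum-++ (map f (map (h b) ys)) (map f rest) ⟩
    sum (map f (map (h b) ys)) + sum (map f rest)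
  ≡⟨ cong₂ _+_ (cong sum (sym (map-∘ ys))) (sum-map-concatMap h f xs ys) ⟩
    sum (map (f ∘ h b) ys) + sum (map (λ c → sum (map (λ b → f (h b c)) xs)) ys)
  ≡⟨ sym (sum-map-+ (f ∘ h b) _ ys) ⟩
    sum (map (λ c → sum (map (λ b → f (h b c)) (b ∷ xs))) ys)
  ∎
  where
  open ≡-Reasoning
  rest = concatMap (λ b → map (h b) ys) xs

-₃_ : Fin 3 → Fin 3
-₃ zero           = zero
-₃ suc zero       = suc (suc zero)
-₃ suc (suc zero) = suc zero

-₃a+₃[a+₃b]≡b : ∀ a b → (-₃ a) +₃ (a +₃ b) ≡ b
-₃a+₃[a+₃b]≡b zero             b                = refl
-₃a+₃[a+₃b]≡b (suc zero)       zero             = refl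
-₃a+₃[a+₃b]≡b (suc zero)       (suc zero)       = refl
-₃a+₃[a+₃b]≡b (suc zero)       (suc (suc zero)) = refl
-₃a+₃[a+₃b]≡b (suc (suc zero)) zero             = refl
-₃a+₃[a+₃b]≡b (suc (suc zero)) (suc zero)       = refl
-₃a+₃[a+₃b]≡b (suc (suc zero)) (suc (suc zero)) = refl

+₃-comm : ∀ a b → a +₃ b ≡ b +₃ a
+₃-comm zero             zero             = refl
+₃-comm zero             (suc zero)       = refl
+₃-comm zero             (suc (suc zero)) = refl
+₃-comm (suc zero)       zero             = refl
+₃-comm (suc zero)       (suc zero)       = refl
+₃-comm (suc zero)       (suc (suc zero)) = refl
+₃-comm (suc (suc zero)) zero             = refl
+₃-comm (suc (suc zero)) (suc zero)       = refl
+₃-comm (suc (suc zero)) (suc (suc zero)) = refl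

+₃-cancelˡ : ∀ a {b c} → a +₃ b ≡ a +₃ c → b ≡ c
+₃-cancelˡ a {b} {c} eq = begin
    b                   ≡⟨ -₃a+₃[a+₃b]≡b a b ⟨
    (-₃ a) +₃ (a +₃ b)  ≡⟨ cong ((-₃ a) +₃_) eq ⟩
    (-₃ a) +₃ (a +₃ c)  ≡⟨ -₃a+₃[a+₃b]≡b a c ⟩
    c                   ∎
  where open ≡-Reasoning

+₃-cancelʳ : ∀ a {b c} → b +₃ a ≡ c +₃ a → b ≡ c
+₃-cancelʳ a {b} {c} eq = +₃-cancelˡ a (trans (+₃-comm a b) (trans eq (+₃-comm c a)))

+₃-identityʳ : ∀ a → a +₃ zero ≡ a
+₃-identityʳ zero             = refl
+₃-identityʳ (suc zero)       = refl
+₃-identityʳ (suc (suc zero)) = refl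

⊕-identityʳ : ∀ {n} (x : Pt n) → x ⊕ replicate n zero ≡ x
⊕-identityʳ []      = refl
⊕-identityʳ (a ∷ x) = cong₂ _∷_ (+₃-identityʳ a) (⊕-identityʳ x)

total : ∀ {n} → (Pt n → ℕ) → ℕ
total {n} f = sum (map f (allPts n))

lineTotal : ∀ {n} → (Pt (suc n) → ℕ) → Pt n → ℕ
lineTotal f x = total {1} (λ a → f (head a ∷ x))

𝟙 : Bool → ℕ
𝟙 b = if b then 1 else 0

∈-allPts : ∀ {n} (x : Pt n) → x ∈ allPts n
∈-allPts []      = here refl
∈-allPts (a ∷ x) =
  ∈-concatMap⁺ (λ b → map (b ∷_) (allPts _)) (lose (∈-allFin a) (∈-map⁺ (a ∷_) (∈-allPts x)))

module _ {n : ℕ} where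

  total-cong : ∀ {f g : Pt n → ℕ} → (∀ x → f x ≡ g x) → total f ≡ total g
  total-cong f≗g = cong sum (map-cong f≗g (allPts n))

  total-mono-≤ : ∀ {f g : Pt n → ℕ} → (∀ x → f x ≤ g x) → total f ≤ total g
  total-mono-≤ f≤g = sum-map-mono-≤ f≤g (allPts n)

  total-mono-< : ∀ {f g : Pt n → ℕ} → (∀ x → f x ≤ g x) → ∀ x → f x < g x → total f < total g
  total-mono-< f≤g x = sum-map-mono-< f≤g (∈-allPts x)

  term≤total : ∀ (f : Pt n → ℕ) x → f x ≤ total f
  term≤total f x = ∈⇒≤sum-map f (∈-allPts x)

  total-* : ∀ k (f : Pt n → ℕ) → total (λ x → k * f x) ≡ k * total f
  total-* k f = sum-map-* k f (allPts n)

  total-lines : ∀ (f : Pt (suc n) → ℕ) → total f ≡ total (lineTotal f)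
  total-lines f = sum-map-concatMap _∷_ f (allFin 3) (allPts n)

total-1 : ∀ n → total {n} (λ _ → 1) ≡ 3 ^ n
total-1 zero    = refl
total-1 (suc n) = begin
    total {suc n} (λ _ → 1)  ≡⟨ total-lines {n} (λ _ → 1) ⟩
    total {n} (λ _ → 3 * 1)  ≡⟨ total-* {n} 3 (λ _ → 1) ⟩
    3 * total {n} (λ _ → 1)  ≡⟨ cong (3 *_) (total-1 n) ⟩
    3 ^ suc n                ∎
  where open ≡-Reasoning

total-embed-≤ : ∀ {n} (H : Affine n) (f : Pt n → ℕ) → total (f ∘ embed H) ≤ total f
total-embed-≤         []            f = ≤-refl
total-embed-≤ {suc n} (nothing ∷ H) f = begin
    total (f ∘ embed (nothing ∷ H))  ≡⟨ total-lines {dim H} _ ⟩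
    total (lineTotal f ∘ embed H)    ≤⟨ total-embed-≤ H (lineTotal f) ⟩
    total (lineTotal f)              ≡⟨ total-lines {n} f ⟨
    total f                          ∎
  where open ≤-Reasoning
total-embed-≤ {suc n} (just c ∷ H)  f = begin
    total (λ y → f (c ∷ embed H y))  ≤⟨ total-embed-≤ H (λ x → f (c ∷ x)) ⟩
    total (λ x → f (c ∷ x))          ≤⟨ total-mono-≤ (λ x → term≤total (λ a → f (head a ∷ x)) (c ∷ [])) ⟩
    total (lineTotal f)              ≡⟨ total-lines {n} f ⟨
    total f                          ∎
  where open ≤-Reasoning

-- size U and fiberSize U x unfold to total (𝟙 ∘ U) and lineTotal (𝟙 ∘ U) x.
size≡total-fiberSize : ∀ {n} (U : Subset3 (suc n)) → size U ≡ total (fiberSize U)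
size≡total-fiberSize {n} U = total-lines {n} (𝟙 ∘ U)

adj?-cong : ∀ {n k} (x y : Pt n) (x′ y′ : Pt k) → dist x y ≡ dist x′ y′ → adj? x y ≡ adj? x′ y′
adj?-cong x y x′ y′ eq with dist x y | dist x′ y′ | eq
... | d | .d | refl = refl

dist≡1⇒Adjacent : ∀ {n} (x y : Pt n) → dist x y ≡ 1 → Adjacent x y
dist≡1⇒Adjacent x y eq with dist x y | eq
... | .1 | refl = refl

Adjacent⇒dist≡1 : ∀ {n} (x y : Pt n) → Adjacent x y → dist x y ≡ 1
Adjacent⇒dist≡1 x y adj with dist x y
Adjacent⇒dist≡1 x y adj | 1           = refl
Adjacent⇒dist≡1 x y ()  | 0
Adjacent⇒dist≡1 x y ()  | suc (suc _)

dist-refl : ∀ {n} (x : Pt n) → dist x x ≡ 0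
dist-refl []      = refl
dist-refl (a ∷ x) with a ≟ a
... | yes _  = dist-refl x
... | no a≢a = ⊥-elim (a≢a refl)

dist≡0⇒≡ : ∀ {n} (x y : Pt n) → dist x y ≡ 0 → x ≡ y
dist≡0⇒≡ []      []      _  = refl
dist≡0⇒≡ (a ∷ x) (b ∷ y) eq with a ≟ b
... | yes refl = cong (a ∷_) (dist≡0⇒≡ x y eq)

Adjacent-line : ∀ {n} a b (x : Pt n) → a ≢ b → Adjacent (a ∷ x) (b ∷ x)
Adjacent-line a b x a≢b = dist≡1⇒Adjacent (a ∷ x) (b ∷ x) dist-line
  where
  dist-line : dist (a ∷ x) (b ∷ x) ≡ 1
  dist-line with a ≟ b
  ... | yes a≡b = ⊥-elim (a≢b a≡b)
  ... | no _    = cong suc (dist-refl x)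

dist-embed : ∀ {n} (H : Affine n) y z → dist (embed H y) (embed H z) ≡ dist y z
dist-embed []            []      []      = refl
dist-embed (nothing ∷ H) (a ∷ y) (b ∷ z) with a ≟ b
... | yes _ = dist-embed H y z
... | no _  = cong suc (dist-embed H y z)
dist-embed (just c ∷ H)  y       z       with c ≟ c
... | yes _  = dist-embed H y z
... | no c≢c = ⊥-elim (c≢c refl)

adj?-embed : ∀ {n} (H : Affine n) y z → adj? (embed H y) (embed H z) ≡ adj? y z
adj?-embed H y z = adj?-cong (embed H y) (embed H z) y z (dist-embed H y z)

inAff?-embed : ∀ {n} (H : Affine n) y → inAff? H (embed H y) ≡ true
inAff?-embed []            []      = refl
inAff?-embed (nothing ∷ H) (a ∷ y) = inAff?-embed H y
inAff?-embed (just c ∷ H)  y with c ≟ c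
... | yes _  = inAff?-embed H y
... | no c≢c = ⊥-elim (c≢c refl)

inAff?⇒embed : ∀ {n} (H : Affine n) {x} → inAff? H x ≡ true → Σ (Pt (dim H)) (λ y → embed H y ≡ x)
inAff?⇒embed []            {[]}    _   = [] , refl
inAff?⇒embed (nothing ∷ H) {a ∷ x} x∈H with inAff?⇒embed H x∈H
... | y , refl = a ∷ y , refl
inAff?⇒embed (just c ∷ H)  {a ∷ x} x∈H with c ≟ a
... | yes refl with inAff?⇒embed H x∈H
...   | y , refl = y , refl

coordSum : ∀ {n} → Pt n → Fin 3
coordSum []      = zero
coordSum (a ∷ x) = a +₃ coordSum x

dist≡1⇒coordSum≢ : ∀ {n} (x y : Pt n) → dist x y ≡ 1 → coordSum x ≢ coordSum y
dist≡1⇒coordSum≢ []      []      ()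
dist≡1⇒coordSum≢ (a ∷ x) (b ∷ y) d≡1 with a ≟ b
... | yes refl = dist≡1⇒coordSum≢ x y d≡1 ∘ +₃-cancelˡ a
... | no a≢b with refl ← dist≡0⇒≡ x y (cong pred d≡1) = a≢b ∘ +₃-cancelʳ (coordSum x)

zeroSum : ∀ {n} → Subset3 n
zeroSum x = does (coordSum x ≟ zero)

zeroSum⇒coordSum≡0 : ∀ {n} (x : Pt n) → zeroSum x ≡ true → coordSum x ≡ zero
zeroSum⇒coordSum≡0 x x∈Z with coordSum x ≟ zero
... | yes s≡0 = s≡0

zeroSum-Independent : ∀ {n} → Independent (zeroSum {n})
zeroSum-Independent x y x∈Z y∈Z adj =
  dist≡1⇒coordSum≢ x y (Adjacent⇒dist≡1 x y adj)
    (trans (zeroSum⇒coordSum≡0 x x∈Z) (sym (zeroSum⇒coordSum≡0 y y∈Z)))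

fiberSize-zeroSum : ∀ {n} (x : Pt n) → fiberSize zeroSum x ≡ 1
fiberSize-zeroSum x with coordSum x
... | zero           = refl
... | suc zero       = refl
... | suc (suc zero) = refl

size-zeroSum : ∀ n → size (zeroSum {suc n}) ≡ 3 ^ n
size-zeroSum n = begin
    size (zeroSum {suc n})        ≡⟨ size≡total-fiberSize (zeroSum {suc n}) ⟩
    total {n} (fiberSize zeroSum) ≡⟨ total-cong {n} fiberSize-zeroSum ⟩
    total {n} (λ _ → 1)           ≡⟨ total-1 n ⟩
    3 ^ n                         ∎
  where open ≡-Reasoning

Independent⇒fiberSize≤1 : ∀ {n} {J : Subset3 (suc n)} → Independent J → ∀ x → fiberSize J x ≤ 1
Independent⇒fiberSize≤1 {J = J} indep x
  with J (zero ∷ x) in J₀ | J (suc zero ∷ x) in J₁ | J (suc (suc zero) ∷ x) in J₂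
... | true  | true  | _     = ⊥-elim (indep _ _ J₀ J₁ (Adjacent-line zero (suc zero) x λ ()))
... | true  | _     | true  = ⊥-elim (indep _ _ J₀ J₂ (Adjacent-line zero (suc (suc zero)) x λ ()))
... | _     | true  | true  = ⊥-elim (indep _ _ J₁ J₂ (Adjacent-line (suc zero) (suc (suc zero)) x λ ()))
... | true  | false | false = ≤-refl
... | false | true  | false = ≤-refl
... | false | false | true  = ≤-refl
... | false | false | false = z≤n

Independent⇒size≤3^n : ∀ {n} {J : Subset3 (suc n)} → Independent J → size J ≤ 3 ^ n
Independent⇒size≤3^n {n} {J} indep = begin
    size J                 ≡⟨ size≡total-fiberSize J ⟩
    total (fiberSize J)    ≤⟨ total-mono-≤ (Independent⇒fiberSize≤1 indep) ⟩
    total {n} (λ _ → 1)    ≡⟨ total-1 n ⟩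
    3 ^ n                  ∎
  where open ≤-Reasoning

MaxIndependent⇒fiberSize≡1 : ∀ {n} {I : Subset3 (suc n)} → MaxIndependent I →
                             ∀ x → fiberSize I x ≡ 1
MaxIndependent⇒fiberSize≡1 {n} {I} (indep , maximum) x =
  ≤-antisym (Independent⇒fiberSize≤1 indep x) (≮⇒≥ λ fiber<1 → n≮n (size I) (size-I<size-I fiber<1))
  where
  open ≤-Reasoning
  size-I<size-I : fiberSize I x < 1 → size I < size I
  size-I<size-I fiber<1 = begin-strict
    size I                 ≡⟨ size≡total-fiberSize I ⟩
    total (fiberSize I)    <⟨ total-mono-< (Independent⇒fiberSize≤1 indep) x fiber<1 ⟩
    total {n} (λ _ → 1)    ≡⟨ total-1 n ⟩
    3 ^ n                  ≡⟨ size-zeroSum n ⟨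
    size (zeroSum {suc n}) ≤⟨ maximum zeroSum zeroSum-Independent ⟩
    size I                 ∎

OneSaturated⇒meets-line : ∀ {n} {U : Subset3 (suc n)} → OneSaturated U →
                          ∀ x → (U (zero ∷ x) ∨ U (suc zero ∷ x) ∨ U (suc (suc zero) ∷ x)) ≡ true
OneSaturated⇒meets-line {n} sat x with sat (zero ∷ x)
... | hit rewrite ⊕-identityʳ (replicate n zero) | ⊕-identityʳ x = hit

OneSaturated⇒1≤fiberSize : ∀ {n} (U : Subset3 (suc n)) → OneSaturated U → ∀ x → 1 ≤ fiberSize U x
OneSaturated⇒1≤fiberSize U sat x
  with U (zero ∷ x) | U (suc zero ∷ x) | U (suc (suc zero) ∷ x) | OneSaturated⇒meets-line {U = U} sat x
... | true  | _     | _     | _ = s≤s z≤n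
... | false | true  | _     | _ = s≤s z≤n
... | false | false | true  | _ = s≤s z≤n
... | false | false | false | ()

∩-⊆ʳ : ∀ {n} (U V : Subset3 n) x → (U ∩ V) x ≡ true → V x ≡ true
∩-⊆ʳ U V x x∈U∩V with U x
... | true = x∈U∩V

embed-∩-inAff? : ∀ {n} (H : Affine n) (U : Subset3 n) → U ∘ embed H ≗ (U ∩ inAff? H) ∘ embed H
embed-∩-inAff? H U y = sym (trans (cong (U (embed H y) ∧_) (inAff?-embed H y)) (∧-identityʳ _))

Canonical-resp-≗ : ∀ {n} {U V : Subset3 n} → U ≗ V → Canonical U → Canonical V
Canonical-resp-≗ {U = U} {V} U≗V (large , (I , maxI , disjoint) , maxDeg) =
  ≤-trans large (≤-reflexive (total-cong (cong 𝟙 ∘ U≗V))) ,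
  (I , maxI , λ x Vx → disjoint x (trans (U≗V x) Vx)) ,
  λ x Vx → ≤-trans (≤-reflexive (total-cong λ y → cong (λ b → 𝟙 (b ∧ adj? x y)) (sym (U≗V y))))
                   (maxDeg x (trans (U≗V x) Vx))

Independent-embed : ∀ {n} (H : Affine n) {I : Subset3 n} → Independent I → Independent (I ∘ embed H)
Independent-embed H indep y z Iy Iz adj =
  indep (embed H y) (embed H z) Iy Iz (trans (adj?-embed H y z) adj)

degIn-embed-≤ : ∀ {n} (H : Affine n) (U : Subset3 n) y → degIn (U ∘ embed H) y ≤ degIn U (embed H y)
degIn-embed-≤ {n} H U y = begin
    degIn (U ∘ embed H) y
  ≡⟨ total-cong (λ z → cong (λ b → 𝟙 (U (embed H z) ∧ b)) (adj?-embed H y z)) ⟨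
    total (neighbour ∘ embed H)
  ≤⟨ total-embed-≤ H neighbour ⟩
    degIn U (embed H y)
  ∎
  where
  open ≤-Reasoning
  neighbour : Pt n → ℕ
  neighbour w = 𝟙 (U w ∧ adj? (embed H y) w)

MaxDegAtMost1-embed : ∀ {n} (H : Affine n) {U : Subset3 n} →
                      MaxDegAtMost1 U → MaxDegAtMost1 (U ∘ embed H)
MaxDegAtMost1-embed H {U} maxDeg y Uy = ≤-trans (degIn-embed-≤ H U y) (maxDeg (embed H y) Uy)

module _ {n} (H : Affine n) where

  MaxIndependent-cylinder : ∀ {I : Subset3 (suc n)} → MaxIndependent I →
                            MaxIndependent (I ∘ embed (nothing ∷ H))
  MaxIndependent-cylinder {I} maxI@(indep , _) =
    Independent-embed (nothing ∷ H) indep , λ J indepJ → begin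
      size J                          ≤⟨ Independent⇒size≤3^n indepJ ⟩
      3 ^ dim H                       ≡⟨ total-1 (dim H) ⟨
      total {dim H} (λ _ → 1)         ≡⟨ total-cong (MaxIndependent⇒fiberSize≡1 maxI ∘ embed H) ⟨
      total (fiberSize I ∘ embed H)   ≡⟨ size≡total-fiberSize (I ∘ embed (nothing ∷ H)) ⟨
      size (I ∘ embed (nothing ∷ H))  ∎
    where open ≤-Reasoning

  size-cylinder : ∀ (U : Subset3 (suc n)) → OneSaturated U → ∀ y₀ → fiberSize U (embed H y₀) ≡ 2 →
                  3 ^ dim H + 1 ≤ size (U ∘ embed (nothing ∷ H))
  size-cylinder U sat y₀ fiber₂ = begin
      3 ^ dim H + 1                  ≡⟨ +-comm (3 ^ dim H) 1 ⟩
      suc (3 ^ dim H)                ≡⟨ cong suc (total-1 (dim H)) ⟨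
      suc (total {dim H} (λ _ → 1))  ≤⟨ total-mono-< (OneSaturated⇒1≤fiberSize U sat ∘ embed H)
                                                        y₀ (≤-reflexive (sym fiber₂)) ⟩
      total (fiberSize U ∘ embed H)  ≡⟨ size≡total-fiberSize (U ∘ embed (nothing ∷ H)) ⟨
      size (U ∘ embed (nothing ∷ H)) ∎
    where open ≤-Reasoning

  Canonical-cylinder : ∀ (U : Subset3 (suc n)) → OneSaturated U → Canonical U →
                       ∀ y₀ → fiberSize U (embed H y₀) ≡ 2 → Canonical (U ∘ embed (nothing ∷ H))
  Canonical-cylinder U sat (_ , (I , maxI , disjoint) , maxDeg) y₀ fiber₂ =
    size-cylinder U sat y₀ fiber₂ ,
    (I ∘ embed (nothing ∷ H) , MaxIndependent-cylinder maxI , disjoint ∘ embed (nothing ∷ H)) ,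
    MaxDegAtMost1-embed (nothing ∷ H) maxDeg

corollary3p13 : (m : ℕ) (U : Subset3 (suc m)) → OneSaturated U → Canonical U
    → (xU : Pt m) → IsExtraPoint U xU
    → (H : Affine (suc m)) → ContainsDir H zero → inAff? (Hred H) xU ≡ true
    → CanonicalFor H (U ∩ inAff? H)
corollary3p13 m U sat canonical xU (fiber₂ , _) (nothing ∷ H) refl xU∈H
  with inAff?⇒embed H xU∈H
... | y₀ , refl =
  ∩-⊆ʳ U (inAff? (nothing ∷ H)) ,
  Canonical-resp-≗ (embed-∩-inAff? (nothing ∷ H) U) (Canonical-cylinder H U sat canonical y₀ fiber₂)
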